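{- Let $n\ge 1$ and let $Q$ be an $L$-shaped minimum blocker of all $n\times n$ $123$-avoiding permutation matrices. Then there exist $(n-1)^2$ linearly independent (as real $n\times n$ matrices) $n\times n$ $123$-avoiding permutation matrices, each of which has exactly one $1$ in a position of $Q$.
   Context: A permutation matrix $P$ contains a $123$-pattern if $I_3$ is a submatrix of $P$; otherwise $P$ is $123$-avoiding. A set of positions is a blocker if every $n\times n$ $123$-avoiding permutation matrix has a $1$ in one of its positions, and minimum if removing any element makes it no longer a blocker. An $L$-shaped blocker $L_n(s,r)$, with positive integers $r+s=n+1$, is the set of $n$ adjacent positions $\{(1,j): n-s+1\le j\le n\}\cup\{(i,n): 1\le i\le r\}$ (width $s$ along row $1$, height $r$ along column $n$, corner at $(1,n)$), or its image under rotation by $180^\circ$, i.e. $\{(n,j): 1\le j\le s\}\cup\{(i,1): n-r+1\le i\le n\}$ (corner at $(n,1)$); positions are (row, column).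
   Formalization: Linear independence of the $(n-1)^2$ matrices is required only against rational coefficients, rather than real ones. -}

module Defs where

open import Data.Nat using (ℕ; zero; suc; _+_; _∸_; _≤_; _<_)
open import Data.Fin using (Fin; toℕ; _≟_)
import Data.Fin as F
open import Data.Fin.Permutation using (Permutation′; _⟨$⟩ʳ_)
open import Data.Rational using (ℚ; 0ℚ; 1ℚ) renaming (_+_ to _+ℚ_; _*_ to _*ℚ_)
open import Data.Product using (Σ; ∃; _×_; _,_)
open import Data.Sum using (_⊎_)
open import Data.Bool using (if_then_else_)
open import Relation.Nullary using (¬_)
open import Relation.Nullary.Decidable using (⌊_⌋)
open import Relation.Binary.PropositionalEquality using (_≡_)
open import Function.Bundles using (_⇔_)

-- A permutation σ of Fin n represents the permutation matrix P with
-- P i j = 1 iff σ i ≡ j (rows/columns 0-indexed).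

permMatrix : ∀ {n} → Permutation′ n → Fin n → Fin n → ℚ
permMatrix σ i j = if ⌊ (σ ⟨$⟩ʳ i) ≟ j ⌋ then 1ℚ else 0ℚ

Contains123 : ∀ {n} → Permutation′ n → Set
Contains123 {n} σ = Σ (Fin n) λ i₁ → Σ (Fin n) λ i₂ → Σ (Fin n) λ i₃ →
  (i₁ F.< i₂) × (i₂ F.< i₃) ×
  ((σ ⟨$⟩ʳ i₁) F.< (σ ⟨$⟩ʳ i₂)) × ((σ ⟨$⟩ʳ i₂) F.< (σ ⟨$⟩ʳ i₃))

Avoids123 : ∀ {n} → Permutation′ n → Set
Avoids123 σ = ¬ Contains123 σ

PosSet : ℕ → Set₁
PosSet n = Fin n → Fin n → Set

Hits : ∀ {n} → PosSet n → Permutation′ n → Set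
Hits {n} Q σ = Σ (Fin n) λ i → Q i (σ ⟨$⟩ʳ i)

HitsExactlyOnce : ∀ {n} → PosSet n → Permutation′ n → Set
HitsExactlyOnce {n} Q σ = Σ (Fin n) λ i → Q i (σ ⟨$⟩ʳ i) ×
  (∀ i′ → Q i′ (σ ⟨$⟩ʳ i′) → i′ ≡ i)

IsBlocker : ∀ {n} → PosSet n → Set
IsBlocker {n} Q = (σ : Permutation′ n) → Avoids123 σ → Hits Q σ

remove : ∀ {n} → PosSet n → Fin n → Fin n → PosSet n
remove Q a b i j = Q i j × ¬ (i ≡ a × j ≡ b)

IsMinimumBlocker : ∀ {n} → PosSet n → Set
IsMinimumBlocker {n} Q = IsBlocker Q × (∀ a b → Q a b → ¬ IsBlocker (remove Q a b))

-- L_n(s,r), 1-indexed in the paper; here 0-indexed: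
-- {(1,j) : n-s+1 ≤ j ≤ n} ∪ {(i,n) : 1 ≤ i ≤ r}
Lcorner : (n s r : ℕ) → PosSet n
Lcorner n s r i j = (toℕ i ≡ 0 × n ∸ s ≤ toℕ j) ⊎ (suc (toℕ j) ≡ n × toℕ i < r)

-- its 180° rotation: {(n,j) : 1 ≤ j ≤ s} ∪ {(i,1) : n-r+1 ≤ i ≤ n}
Lrotated : (n s r : ℕ) → PosSet n
Lrotated n s r i j = (suc (toℕ i) ≡ n × toℕ j < s) ⊎ (toℕ j ≡ 0 × n ∸ r ≤ toℕ i)

SameSet : ∀ {n} → PosSet n → PosSet n → Set
SameSet {n} Q R = ∀ (i j : Fin n) → Q i j ⇔ R i j

IsLShaped : ∀ {n} → PosSet n → Set
IsLShaped {n} Q = Σ ℕ λ s → Σ ℕ λ r → (1 ≤ s) × (1 ≤ r) × (r + s ≡ suc n) ×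
  (SameSet Q (Lcorner n s r) ⊎ SameSet Q (Lrotated n s r))

sumFin : ∀ {m} → (Fin m → ℚ) → ℚ
sumFin {zero} f = 0ℚ
sumFin {suc m} f = f F.zero +ℚ sumFin (λ k → f (F.suc k))

LinearlyIndependent : ∀ {m n} → (Fin m → Permutation′ n) → Set
LinearlyIndependent {m} {n} P = (c : Fin m → ℚ) →
  (∀ (i j : Fin n) → sumFin (λ k → c k *ℚ permMatrix (P k) i j) ≡ 0ℚ) →
  ∀ k → c k ≡ 0ℚ

{-# OPTIONS --safe #-}

-- Up to a rotation by 180°, which preserves 123-avoidance, linear independence and hitting
-- exactly once, Q is the L with corner (0, m), m = n - 1: row 0 from column R on and column m
-- down to row R. Every permutation used is a union of two decreasing runs, hence 123-avoiding.
-- The family is indexed by (u, j) ∈ [0, m - 1]². Off the antidiagonals u + j ∈ {m - 1, m}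
-- the member puts a 1 at (u + 1, j) and the anti-identity on the other rows and columns; it
-- meets Q only at the corner (0, m). On those two antidiagonals such members would be
-- dependent, so the index (R, m - R) takes the anti-identity and every other index the
-- anti-identity with its first two segments swapped so that 0 ↦ u; that one meets Q only at
-- (0, u) or only in column m. Each member has a pivot entry that no other member of the same
-- or higher rank contains, so the family is triangular, hence independent.

module Submission where

open import Defs
open import Data.Bool using (Bool; true; false)
import Data.Bool.Properties as Bool
open import Data.Empty using (⊥; ⊥-elim)
open import Data.Fin as F using (Fin; toℕ; fromℕ<; opposite)
import Data.Fin.Properties as F
open import Data.Fin.Permutation using (Permutation′; _⟨$⟩ʳ_; permutation; reverse; _∘ₚ_)
open import Data.Nat
open import Data.Nat.Induction using (<-rec)
open import Data.Nat.Properties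
open import Data.Product using (Σ; ∃; _×_; _,_; proj₁; proj₂; uncurry)
open import Data.Product.Function.NonDependent.Propositional using (_×-⇔_)
open import Data.Rational using (ℚ; 0ℚ; 1ℚ) renaming (_+_ to _+ℚ_; _*_ to _*ℚ_)
import Data.Rational.Properties as ℚ
open import Data.Sum using (_⊎_; inj₁; inj₂; map₁)
open import Data.Sum.Function.Propositional using (_⊎-⇔_)
open import Function using (_∘_)
open import Function.Bundles using (Equivalence; _⇔_; mk⇔)
import Function.Properties.Equivalence as ⇔
open import Function.Definitions using (Injective)
open import Relation.Binary.Definitions using (tri<; tri≈; tri>)
open import Relation.Binary.PropositionalEquality
open import Relation.Nullary using (yes; no; isYes)

injective⇒surjective : ∀ {n} (g : Fin n → Fin n) → Injective _≡_ _≡_ g →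
  ∀ y → ∃ λ x → g x ≡ y
injective⇒surjective {suc n} g g-injective y with F.any? (λ x → g x F.≟ y)
... | yes hit = hit
... | no miss = ⊥-elim (<-irrefl refl (F.injective⇒≤ punchOut∘g-injective))
  where
  y≢g : ∀ x → y ≢ g x
  y≢g x y≡gx = miss (x , sym y≡gx)

  punchOut∘g-injective : Injective _≡_ _≡_ (λ x → F.punchOut (y≢g x))
  punchOut∘g-injective = g-injective ∘ F.punchOut-injective (y≢g _) (y≢g _)

injective⇒permutation : ∀ {n} (g : Fin n → Fin n) → Injective _≡_ _≡_ g → Permutation′ n
injective⇒permutation g g-injective =
  permutation g (proj₁ ∘ preimage) (proj₂ ∘ preimage) (λ x → g-injective (proj₂ (preimage (g x))))
  where
  preimage : ∀ y → ∃ λ x → g x ≡ y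
  preimage = injective⇒surjective g g-injective

pigeonhole-Bool : ∀ (a b c : Bool) → a ≡ b ⊎ b ≡ c ⊎ a ≡ c
pigeonhole-Bool false false _     = inj₁ refl
pigeonhole-Bool true  true  _     = inj₁ refl
pigeonhole-Bool false true  true  = inj₂ (inj₁ refl)
pigeonhole-Bool true  false false = inj₂ (inj₁ refl)
pigeonhole-Bool false true  false = inj₂ (inj₂ refl)
pigeonhole-Bool true  false true  = inj₂ (inj₂ refl)

record TwoDecreasingRuns (n : ℕ) (f : ℕ → ℕ) : Set where
  field
    bounded    : ∀ {x} → x < n → f x < n
    run        : ℕ → Bool
    decreasing : ∀ {x y} → x < y → y < n → run x ≡ run y → f y < f x
    separated  : ∀ {x y} → x < n → y < n → run x ≢ run y → f x ≢ f y

  injective : ∀ {x y} → x < n → y < n → f x ≡ f y → x ≡ y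
  injective {x} {y} x<n y<n fx≡fy with <-cmp x y | run x Bool.≟ run y
  ... | tri≈ _ x≡y _ | _      = x≡y
  ... | tri< x<y _ _ | yes same = ⊥-elim (<-irrefl (sym fx≡fy) (decreasing x<y y<n same))
  ... | tri> _ _ y<x | yes same = ⊥-elim (<-irrefl fx≡fy (decreasing y<x x<n (sym same)))
  ... | _            | no other = ⊥-elim (separated x<n y<n other fx≡fy)

  private
    toFin : Fin n → Fin n
    toFin x = fromℕ< (bounded (F.toℕ<n x))

    toℕ-toFin : ∀ x → toℕ (toFin x) ≡ f (toℕ x)
    toℕ-toFin x = F.toℕ-fromℕ< _

    toFin-injective : Injective _≡_ _≡_ toFin
    toFin-injective {x} {y} toFin-x≡toFin-y =
      F.toℕ-injective (injective (F.toℕ<n x) (F.toℕ<n y) (begin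
        f (toℕ x)      ≡⟨ toℕ-toFin x ⟨
        toℕ (toFin x)  ≡⟨ cong toℕ toFin-x≡toFin-y ⟩
        toℕ (toFin y)  ≡⟨ toℕ-toFin y ⟩
        f (toℕ y)      ∎))
      where open ≡-Reasoning

  toPermutation : Permutation′ n
  toPermutation = injective⇒permutation toFin toFin-injective

  toℕ-toPermutation : ∀ x → toℕ (toPermutation ⟨$⟩ʳ x) ≡ f (toℕ x)
  toℕ-toPermutation = toℕ-toFin

  private
    ascent : ∀ {i j} → toPermutation ⟨$⟩ʳ i F.< toPermutation ⟨$⟩ʳ j → f (toℕ i) < f (toℕ j)
    ascent {i} {j} = subst₂ _<_ (toℕ-toPermutation i) (toℕ-toPermutation j)

  toPermutation-avoids123 : Avoids123 toPermutation
  toPermutation-avoids123 (i₁ , i₂ , i₃ , i₁<i₂ , i₂<i₃ , σ₁<σ₂ , σ₂<σ₃)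
    with pigeonhole-Bool (run (toℕ i₁)) (run (toℕ i₂)) (run (toℕ i₃))
  ... | inj₁ same₁₂ = <-asym (decreasing i₁<i₂ (F.toℕ<n i₂) same₁₂) (ascent σ₁<σ₂)
  ... | inj₂ (inj₁ same₂₃) = <-asym (decreasing i₂<i₃ (F.toℕ<n i₃) same₂₃) (ascent σ₂<σ₃)
  ... | inj₂ (inj₂ same₁₃) = <-asym (decreasing (<-trans i₁<i₂ i₂<i₃) (F.toℕ<n i₃) same₁₃)
                                    (<-trans (ascent σ₁<σ₂) (ascent σ₂<σ₃))

HitsExactlyOnceℕ : ℕ → (ℕ → ℕ → Set) → (ℕ → ℕ) → Set
HitsExactlyOnceℕ n Q f = Σ ℕ λ h → h < n × Q h (f h) × (∀ x → x < n → Q x (f x) → x ≡ h)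

toPermutation-hitsExactlyOnce : ∀ {n f} (runs : TwoDecreasingRuns n f) {Q : ℕ → ℕ → Set} →
  HitsExactlyOnceℕ n Q f →
  HitsExactlyOnce (λ i j → Q (toℕ i) (toℕ j)) (TwoDecreasingRuns.toPermutation runs)
toPermutation-hitsExactlyOnce {f = f} runs {Q} (h , h<n , hit , unique) = fromℕ< h<n , hit′ , unique′
  where
  open TwoDecreasingRuns runs using (toPermutation; toℕ-toPermutation)

  hit′ : Q (toℕ (fromℕ< h<n)) (toℕ (toPermutation ⟨$⟩ʳ fromℕ< h<n))
  hit′ = subst₂ Q (sym (F.toℕ-fromℕ< h<n))
    (sym (trans (toℕ-toPermutation (fromℕ< h<n)) (cong f (F.toℕ-fromℕ< h<n)))) hit

  unique′ : ∀ i → Q (toℕ i) (toℕ (toPermutation ⟨$⟩ʳ i)) → i ≡ fromℕ< h<n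
  unique′ i hit-i = F.toℕ-injective (trans
    (unique (toℕ i) (F.toℕ<n i) (subst (Q (toℕ i)) (toℕ-toPermutation i) hit-i))
    (sym (F.toℕ-fromℕ< h<n)))

permMatrix-hit : ∀ {n} (σ : Permutation′ n) {i j} → σ ⟨$⟩ʳ i ≡ j → permMatrix σ i j ≡ 1ℚ
permMatrix-hit σ {i} {j} σi≡j with σ ⟨$⟩ʳ i F.≟ j
... | yes _    = refl
... | no σi≢j = ⊥-elim (σi≢j σi≡j)

permMatrix-cong : ∀ {n} (σ τ : Permutation′ n) {i j i′ j′} →
  (σ ⟨$⟩ʳ i ≡ j ⇔ τ ⟨$⟩ʳ i′ ≡ j′) → permMatrix σ i j ≡ permMatrix τ i′ j′
permMatrix-cong σ τ {i} {j} {i′} {j′} σ⇔τ with σ ⟨$⟩ʳ i F.≟ j | τ ⟨$⟩ʳ i′ F.≟ j′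
... | yes _    | yes _    = refl
... | no _     | no _     = refl
... | yes σ-hit | no τ-miss = ⊥-elim (τ-miss (Equivalence.to σ⇔τ σ-hit))
... | no σ-miss | yes τ-hit = ⊥-elim (σ-miss (Equivalence.from σ⇔τ τ-hit))

sumFin-cong : ∀ {M} {f g : Fin M → ℚ} → (∀ k → f k ≡ g k) → sumFin f ≡ sumFin g
sumFin-cong {zero}  _   = refl
sumFin-cong {suc M} f≗g = cong₂ _+ℚ_ (f≗g F.zero) (sumFin-cong (f≗g ∘ F.suc))

sumFin-zero : ∀ {M} (f : Fin M → ℚ) → (∀ k → f k ≡ 0ℚ) → sumFin f ≡ 0ℚ
sumFin-zero {zero}  _ _   = refl
sumFin-zero {suc M} f f≗0 =
  trans (cong₂ _+ℚ_ (f≗0 F.zero) (sumFin-zero (f ∘ F.suc) (f≗0 ∘ F.suc))) (ℚ.+-identityʳ 0ℚ)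

sumFin-single : ∀ {M} (f : Fin M → ℚ) k → (∀ k′ → k′ ≢ k → f k′ ≡ 0ℚ) → sumFin f ≡ f k
sumFin-single {suc M} f F.zero    others = trans
  (cong (f F.zero +ℚ_) (sumFin-zero (f ∘ F.suc) (λ k′ → others (F.suc k′) λ ())))
  (ℚ.+-identityʳ (f F.zero))
sumFin-single {suc M} f (F.suc k) others = trans
  (cong₂ _+ℚ_ (others F.zero λ ())
              (sumFin-single (f ∘ F.suc) k λ k′ k′≢k → others (F.suc k′) (k′≢k ∘ F.suc-injective)))
  (ℚ.+-identityˡ (f (F.suc k)))

linearlyIndependent-triangular : ∀ {M n} (P : Fin M → Permutation′ n) (row col : Fin M → Fin n)
  (rank : Fin M → ℕ) → (∀ k → P k ⟨$⟩ʳ row k ≡ col k) →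
  (∀ k k′ → P k′ ⟨$⟩ʳ row k ≡ col k → k′ ≡ k ⊎ rank k′ < rank k) →
  LinearlyIndependent P
linearlyIndependent-triangular P row col rank pivot triangular c combination≡0 k =
  <-rec Vanishes vanishes (rank k) k refl
  where
  Vanishes : ℕ → Set
  Vanishes r = ∀ k → rank k ≡ r → c k ≡ 0ℚ

  vanishes : ∀ r → (∀ {r′} → r′ < r → Vanishes r′) → Vanishes r
  vanishes r lower k refl = begin
    c k                                                        ≡⟨ ℚ.*-identityʳ (c k) ⟨
    c k *ℚ 1ℚ                                                  ≡⟨ cong (c k *ℚ_) (permMatrix-hit (P k) (pivot k)) ⟨
    c k *ℚ permMatrix (P k) (row k) (col k)                    ≡⟨ sumFin-single _ k others ⟨
    sumFin (λ k′ → c k′ *ℚ permMatrix (P k′) (row k) (col k))  ≡⟨ combination≡0 (row k) (col k) ⟩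
    0ℚ                                                         ∎
    where
    open ≡-Reasoning
    others : ∀ k′ → k′ ≢ k → c k′ *ℚ permMatrix (P k′) (row k) (col k) ≡ 0ℚ
    others k′ k′≢k with P k′ ⟨$⟩ʳ row k F.≟ col k
    ... | no _    = ℚ.*-zeroʳ (c k′)
    ... | yes hit with triangular k k′ hit
    ...   | inj₁ k′≡k  = ⊥-elim (k′≢k k′≡k)
    ...   | inj₂ below = trans (cong (_*ℚ 1ℚ) (lower below k′ refl)) (ℚ.*-zeroˡ 1ℚ)

rotate : ∀ {n} → Permutation′ n → Permutation′ n
rotate σ = reverse ∘ₚ σ ∘ₚ reverse

rotateSet : ∀ {n} → PosSet n → PosSet n
rotateSet Q i j = Q (opposite i) (opposite j)

opposite-injective : ∀ {n} {i j : Fin n} → opposite i ≡ opposite j → i ≡ j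
opposite-injective {i = i} {j} opposite-i≡opposite-j =
  trans (sym (F.opposite-involutive i)) (trans (cong opposite opposite-i≡opposite-j) (F.opposite-involutive j))

opposite-< : ∀ {n} {i j : Fin n} → i F.< j → opposite j F.< opposite i
opposite-< {i = i} {j} i<j rewrite F.opposite-prop i | F.opposite-prop j = ∸-monoʳ-< (s≤s i<j) (F.toℕ<n j)

opposite-cancel-< : ∀ {n} {i j : Fin n} → opposite i F.< opposite j → j F.< i
opposite-cancel-< {i = i} {j} = subst₂ F._<_ (F.opposite-involutive j) (F.opposite-involutive i) ∘ opposite-<

rotate-opposite : ∀ {n} (σ : Permutation′ n) i → rotate σ ⟨$⟩ʳ opposite i ≡ opposite (σ ⟨$⟩ʳ i)
rotate-opposite σ i = cong (λ k → opposite (σ ⟨$⟩ʳ k)) (F.opposite-involutive i)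

rotate-avoids123 : ∀ {n} (σ : Permutation′ n) → Avoids123 σ → Avoids123 (rotate σ)
rotate-avoids123 σ avoids (i₁ , i₂ , i₃ , i₁<i₂ , i₂<i₃ , σ₁<σ₂ , σ₂<σ₃) = avoids
  ( opposite i₃ , opposite i₂ , opposite i₁ , opposite-< i₂<i₃ , opposite-< i₁<i₂
  , opposite-cancel-< σ₂<σ₃ , opposite-cancel-< σ₁<σ₂)

permMatrix-rotate : ∀ {n} (σ : Permutation′ n) i j →
  permMatrix (rotate σ) (opposite i) (opposite j) ≡ permMatrix σ i j
permMatrix-rotate σ i j = permMatrix-cong (rotate σ) σ (mk⇔
  (λ hit → opposite-injective (trans (sym (rotate-opposite σ i)) hit))
  (λ hit → trans (rotate-opposite σ i) (cong opposite hit)))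

rotate-linearlyIndependent : ∀ {M n} (P : Fin M → Permutation′ n) →
  LinearlyIndependent P → LinearlyIndependent (rotate ∘ P)
rotate-linearlyIndependent P independent c combination≡0 = independent c λ i j → trans
  (sumFin-cong (λ k → cong (c k *ℚ_) (sym (permMatrix-rotate (P k) i j))))
  (combination≡0 (opposite i) (opposite j))

rotate-hitsExactlyOnce : ∀ {n} {Q : PosSet n} (σ : Permutation′ n) →
  HitsExactlyOnce Q σ → HitsExactlyOnce (rotateSet Q) (rotate σ)
rotate-hitsExactlyOnce {Q = Q} σ (h , hit , unique) = opposite h , hit′ , unique′
  where
  hit′ : Q (opposite (opposite h)) (opposite (opposite (σ ⟨$⟩ʳ opposite (opposite h))))
  hit′ rewrite F.opposite-involutive h | F.opposite-involutive (σ ⟨$⟩ʳ h) = hit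

  unique′ : ∀ i → Q (opposite i) (opposite (opposite (σ ⟨$⟩ʳ opposite i))) → i ≡ opposite h
  unique′ i hit-i rewrite F.opposite-involutive (σ ⟨$⟩ʳ opposite i) =
    trans (sym (F.opposite-involutive i)) (cong opposite (unique (opposite i) hit-i))

hitsExactlyOnce-sameSet : ∀ {n} {Q Q′ : PosSet n} → SameSet Q Q′ →
  ∀ σ → HitsExactlyOnce Q′ σ → HitsExactlyOnce Q σ
hitsExactlyOnce-sameSet Q≈Q′ σ (h , hit , unique) =
  h , Equivalence.from (Q≈Q′ _ _) hit , λ i → unique i ∘ Equivalence.to (Q≈Q′ _ _)

SingleHitFamily : ∀ {n} → ℕ → PosSet n → Set
SingleHitFamily {n} M Q = Σ (Fin M → Permutation′ n) λ P →
  LinearlyIndependent P × (∀ k → Avoids123 (P k) × HitsExactlyOnce Q (P k))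

singleHitFamily-sameSet : ∀ {n M} {Q Q′ : PosSet n} → SameSet Q Q′ →
  SingleHitFamily M Q′ → SingleHitFamily M Q
singleHitFamily-sameSet Q≈Q′ (P , independent , good) =
  P , independent , λ k → proj₁ (good k) , hitsExactlyOnce-sameSet Q≈Q′ (P k) (proj₂ (good k))

singleHitFamily-rotate : ∀ {n M} {Q : PosSet n} → SingleHitFamily M Q → SingleHitFamily M (rotateSet Q)
singleHitFamily-rotate {Q = Q} (P , independent , good) =
  rotate ∘ P , rotate-linearlyIndependent P independent ,
  λ k → rotate-avoids123 (P k) (proj₁ (good k)) , rotate-hitsExactlyOnce {Q = Q} (P k) (proj₂ (good k))

module _ (x x̄ : ℕ) {n : ℕ} (complementary : suc x + x̄ ≡ n) where

  complementary-sym : suc x̄ + x ≡ n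
  complementary-sym = trans (cong suc (+-comm x̄ x)) complementary

  complement≡0⇔ : x̄ ≡ 0 ⇔ suc x ≡ n
  complement≡0⇔ = mk⇔
    (λ x̄≡0 → trans (sym (+-identityʳ (suc x))) (subst (λ z → suc x + z ≡ n) x̄≡0 complementary))
    (λ 1+x≡n → +-cancelˡ-≡ (suc x) x̄ 0
      (trans complementary (trans (sym 1+x≡n) (sym (+-identityʳ (suc x))))))

  ∸≤complement⇔ : ∀ t → n ∸ t ≤ x̄ ⇔ x < t
  ∸≤complement⇔ t = mk⇔
    (λ n∸t≤x̄ → +-cancelʳ-≤ x̄ (suc x) t
      (subst (_≤ t + x̄) (sym complementary) (≤-trans (m≤n+m∸n n t) (+-monoʳ-≤ t n∸t≤x̄))))
    (λ x<t → m≤n+o⇒m∸n≤o n t (subst (_≤ t + x̄) complementary (+-monoˡ-≤ x̄ x<t)))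

toℕ-opposite-complementary : ∀ {n} (i : Fin n) → suc (toℕ i) + toℕ (opposite i) ≡ n
toℕ-opposite-complementary i rewrite F.opposite-prop i = m+[n∸m]≡n (F.toℕ<n i)

Lrotated≈rotateSet-Lcorner : ∀ n s r → SameSet (Lrotated n s r) (rotateSet (Lcorner n s r))
Lrotated≈rotateSet-Lcorner n s r i j = ⇔.sym
  (   (complement≡0⇔ x x̄ x+x̄ ×-⇔ ∸≤complement⇔ y ȳ y+ȳ s)
  ⊎-⇔ (⇔.sym (complement≡0⇔ ȳ y (complementary-sym y ȳ y+ȳ)) ×-⇔
       ⇔.sym (∸≤complement⇔ x̄ x (complementary-sym x x̄ x+x̄) r)))
  where
  x x̄ y ȳ : ℕ
  x = toℕ i
  x̄ = toℕ (opposite i)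
  y = toℕ j
  ȳ = toℕ (opposite j)

  x+x̄ : suc x + x̄ ≡ n
  x+x̄ = toℕ-opposite-complementary i

  y+ȳ : suc y + ȳ ≡ n
  y+ȳ = toℕ-opposite-complementary j

punchInℕ : ℕ → ℕ → ℕ
punchInℕ j y with y <? j
... | yes _ = y
... | no _  = suc y

punchOutℕ : ℕ → ℕ → ℕ
punchOutℕ i x with x <? i
... | yes _ = x
... | no _  = pred x

punchInℕ-≥ : ∀ {j y} → j ≤ y → punchInℕ j y ≡ suc y
punchInℕ-≥ {j} {y} j≤y with y <? j
... | yes y<j = ⊥-elim (<⇒≱ y<j j≤y)
... | no _    = refl

punchInℕ-≤ : ∀ j y → punchInℕ j y ≤ suc y
punchInℕ-≤ j y with y <? j
... | yes _ = n≤1+n y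
... | no _  = ≤-refl

≤-punchInℕ : ∀ j y → y ≤ punchInℕ j y
≤-punchInℕ j y with y <? j
... | yes _ = ≤-refl
... | no _  = n≤1+n y

punchInℕ≢ : ∀ j y → punchInℕ j y ≢ j
punchInℕ≢ j y with y <? j
... | yes y<j = <⇒≢ y<j
... | no y≮j = λ 1+y≡j → y≮j (≤-reflexive 1+y≡j)

punchInℕ-mono-< : ∀ j {y z} → y < z → punchInℕ j y < punchInℕ j z
punchInℕ-mono-< j {y} {z} y<z with y <? j | z <? j
... | yes _   | yes _ = y<z
... | yes _   | no _  = m<n⇒m<1+n y<z
... | no y≮j | yes z<j = ⊥-elim (y≮j (<-trans y<z z<j))
... | no _    | no _  = s≤s y<z

punchOutℕ-< : ∀ {i x} → x < i → punchOutℕ i x ≡ x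
punchOutℕ-< {i} {x} x<i with x <? i
... | yes _   = refl
... | no x≮i = ⊥-elim (x≮i x<i)

punchOutℕ-> : ∀ {i x} → i < x → punchOutℕ i x ≡ pred x
punchOutℕ-> {i} {x} i<x with x <? i
... | yes x<i = ⊥-elim (<-asym x<i i<x)
... | no _    = refl

≢⇒<⊎> : ∀ {x i} → x ≢ i → x < i ⊎ i < x
≢⇒<⊎> {x} {i} x≢i with <-cmp x i
... | tri< x<i _ _ = inj₁ x<i
... | tri≈ _ x≡i _ = ⊥-elim (x≢i x≡i)
... | tri> _ _ i<x = inj₂ i<x

punchOutℕ-mono-< : ∀ i {x y} → x < y → x ≢ i → y ≢ i → punchOutℕ i x < punchOutℕ i y
punchOutℕ-mono-< i {x} {y} x<y x≢i y≢i with ≢⇒<⊎> x≢i | ≢⇒<⊎> y≢i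
... | inj₁ x<i | inj₁ y<i rewrite punchOutℕ-< x<i | punchOutℕ-< y<i = x<y
... | inj₁ x<i | inj₂ i<y rewrite punchOutℕ-< x<i | punchOutℕ-> i<y = <-≤-trans x<i (<⇒≤pred i<y)
... | inj₂ i<x | inj₁ y<i = ⊥-elim (<-asym (<-trans i<x x<y) y<i)
... | inj₂ i<x | inj₂ i<y rewrite punchOutℕ-> i<x | punchOutℕ-> i<y =
  pred-mono-< ⦃ >-nonZero (≤-<-trans z≤n i<x) ⦄ x<y

punchOutℕ-≤ : ∀ {i x p} → x ≢ i → x ≤ suc p → i ≤ suc p → punchOutℕ i x ≤ p
punchOutℕ-≤ {i} {x} x≢i x≤1+p i≤1+p with ≢⇒<⊎> x≢i
... | inj₁ x<i rewrite punchOutℕ-< x<i = s≤s⁻¹ (<-≤-trans x<i i≤1+p)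
... | inj₂ i<x rewrite punchOutℕ-> i<x = pred-mono-≤ x≤1+p


constant-sum⇒decreasing : ∀ {x y v w s} → x + v ≡ s → y + w ≡ s → x < y → w < v
constant-sum⇒decreasing {x} {y} {v} {w} x+v≡s y+w≡s x<y =
  +-cancelˡ-< y w v (subst (_< y + v) (trans x+v≡s (sym y+w≡s)) (+-monoˡ-< v x<y))

same-antidiagonal : ∀ {u j u′ j′ t} → u′ ≡ u → u′ + j′ ≡ t → u + j ≡ t → u′ ≡ u × j′ ≡ j
same-antidiagonal {u} refl u+j′≡t u+j≡t = refl , +-cancelˡ-≡ u _ _ (trans u+j′≡t (sym u+j≡t))

module Construction (p : ℕ) where

  m n : ℕ
  m = suc p
  n = suc m

  antidiagonal-sum : ∀ j {t} → t ≤ p → p ≤ t + punchInℕ j (p ∸ t) × t + punchInℕ j (p ∸ t) ≤ m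
  antidiagonal-sum j {t} t≤p =
      subst (_≤ t + punchInℕ j (p ∸ t)) t+[p∸t]≡p (+-monoʳ-≤ t (≤-punchInℕ j (p ∸ t)))
    , subst (t + punchInℕ j (p ∸ t) ≤_) (trans (+-suc t (p ∸ t)) (cong suc t+[p∸t]≡p))
        (+-monoʳ-≤ t (punchInℕ-≤ j (p ∸ t)))
    where
    t+[p∸t]≡p : t + (p ∸ t) ≡ p
    t+[p∸t]≡p = m+[n∸m]≡n t≤p

  -- insert i j reverse from Data.Fin.Permutation, on ℕ: a 1 at (i, j) and the anti-identity
  -- on the remaining rows and columns.
  insertReverse : ℕ → ℕ → ℕ → ℕ
  insertReverse i j x with x ≟ i
  ... | yes _ = j
  ... | no _  = punchInℕ j (p ∸ punchOutℕ i x)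

  insertReverse-≡ : ∀ i j → insertReverse i j i ≡ j
  insertReverse-≡ i j with i ≟ i
  ... | yes _   = refl
  ... | no i≢i = ⊥-elim (i≢i refl)

  insertReverse-≢ : ∀ {i j x} → x ≢ i → insertReverse i j x ≡ punchInℕ j (p ∸ punchOutℕ i x)
  insertReverse-≢ {i} {j} {x} x≢i with x ≟ i
  ... | yes x≡i = ⊥-elim (x≢i x≡i)
  ... | no _    = refl

  insertReverse-runs : ∀ {i j} → i ≤ m → j ≤ m → TwoDecreasingRuns n (insertReverse i j)
  insertReverse-runs {i} {j} i≤m j≤m = record
    { bounded = bounded ; run = λ x → isYes (x ≟ i) ; decreasing = decreasing ; separated = separated }
    where
    bounded : ∀ {x} → x < n → insertReverse i j x < n
    bounded {x} _ with x ≟ i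
    ... | yes _ = s≤s j≤m
    ... | no _  = s≤s (≤-trans (punchInℕ-≤ j _) (s≤s (m∸n≤m p (punchOutℕ i x))))

    decreasing : ∀ {x y} → x < y → y < n → isYes (x ≟ i) ≡ isYes (y ≟ i) →
      insertReverse i j y < insertReverse i j x
    decreasing {x} {y} x<y y<n same-run with x ≟ i | y ≟ i
    ... | yes refl | yes refl = ⊥-elim (<-irrefl refl x<y)
    decreasing _ _ () | yes _ | no _
    decreasing _ _ () | no _  | yes _
    ... | no x≢i   | no y≢i   = punchInℕ-mono-< j
      (∸-monoʳ-< (punchOutℕ-mono-< i x<y x≢i y≢i) (punchOutℕ-≤ y≢i (s≤s⁻¹ y<n) i≤m))

    separated : ∀ {x y} → x < n → y < n → isYes (x ≟ i) ≢ isYes (y ≟ i) →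
      insertReverse i j x ≢ insertReverse i j y
    separated {x} {y} _ _ other-run with x ≟ i | y ≟ i
    ... | yes _ | yes _ = ⊥-elim (other-run refl)
    ... | no _  | no _  = ⊥-elim (other-run refl)
    ... | yes _ | no _  = punchInℕ≢ j _ ∘ sym
    ... | no _  | yes _ = punchInℕ≢ j _

  insertReverse-0 : ∀ {i j} → 1 ≤ i → j ≤ p → insertReverse i j 0 ≡ m
  insertReverse-0 {i} {j} 1≤i j≤p = begin
    insertReverse i j 0            ≡⟨ insertReverse-≢ (<⇒≢ 1≤i) ⟩
    punchInℕ j (p ∸ punchOutℕ i 0) ≡⟨ cong (λ t → punchInℕ j (p ∸ t)) (punchOutℕ-< 1≤i) ⟩
    punchInℕ j p                   ≡⟨ punchInℕ-≥ j≤p ⟩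
    m                              ∎
    where open ≡-Reasoning

  insertReverse-≡m : ∀ {i j x} → 1 ≤ i → i ≤ m → j ≤ p → x < n → insertReverse i j x ≡ m → x ≡ 0
  insertReverse-≡m 1≤i i≤m j≤p x<n hit =
    TwoDecreasingRuns.injective (insertReverse-runs i≤m (m≤n⇒m≤1+n j≤p))
      x<n z<s (trans hit (sym (insertReverse-0 1≤i j≤p)))

  insertReverse-band : ∀ {i j x} → x ≢ i → x ≤ m → i ≤ m →
    x + insertReverse i j x ≤ suc m × (i + j ≤ m → m ≤ x + insertReverse i j x)
  insertReverse-band {i} {j} {x} x≢i x≤m i≤m rewrite insertReverse-≢ {j = j} x≢i with ≢⇒<⊎> x≢i
  ... | inj₁ x<i rewrite punchOutℕ-< x<i =
    m≤n⇒m≤1+n (proj₂ (antidiagonal-sum j x≤p)) , ≤-reflexive ∘ sym ∘ on-antidiagonal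
    where
    open ≡-Reasoning
    x≤p : x ≤ p
    x≤p = s≤s⁻¹ (<-≤-trans x<i i≤m)

    on-antidiagonal : i + j ≤ m → x + punchInℕ j (p ∸ x) ≡ m
    on-antidiagonal i+j≤m = begin
      x + punchInℕ j (p ∸ x)  ≡⟨ cong (x +_) (punchInℕ-≥ j≤p∸x) ⟩
      x + suc (p ∸ x)         ≡⟨ +-suc x (p ∸ x) ⟩
      suc (x + (p ∸ x))       ≡⟨ cong suc (m+[n∸m]≡n x≤p) ⟩
      m                       ∎
      where
      j≤p∸x : j ≤ p ∸ x
      j≤p∸x = m+n≤o⇒m≤o∸n j
        (subst (_≤ p) (+-comm x j) (s≤s⁻¹ (≤-trans (+-monoˡ-≤ j x<i) i+j≤m)))
  insertReverse-band {i} {j} {suc x} x≢i x≤m i≤m | inj₂ i<x rewrite punchOutℕ-> i<x =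
    s≤s (proj₂ (antidiagonal-sum j x≤p)) , λ _ → s≤s (proj₁ (antidiagonal-sum j x≤p))
    where
    x≤p : x ≤ p
    x≤p = s≤s⁻¹ x≤m

  insertReverse-hit : ∀ {i j x y} → x ≤ m → i ≤ m → insertReverse i j x ≡ y →
    (x ≡ i × y ≡ j) ⊎ (x + y ≤ suc m × (i + j ≤ m → m ≤ x + y))
  insertReverse-hit {i} {j} {x} x≤m i≤m refl with <-cmp x i
  ... | tri≈ _ refl _ = inj₁ (refl , insertReverse-≡ i j)
  ... | tri< _ x≢i _  = inj₂ (insertReverse-band x≢i x≤m i≤m)
  ... | tri> _ x≢i _  = inj₂ (insertReverse-band x≢i x≤m i≤m)

  -- The word m, m - 1, …, 0 of the anti-identity with its first two segments,
  -- m … b + 1 and b … b + 1 - a, swapped.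
  blockSwap : ℕ → ℕ → ℕ → ℕ
  blockSwap a b x with x <? a
  ... | yes _ = b ∸ x
  ... | no _ with x <? a + (m ∸ b)
  ...   | yes _ = (m + a) ∸ x
  ...   | no _  = m ∸ x

  inMiddleBlock : ℕ → ℕ → ℕ → Bool
  inMiddleBlock a b x with x <? a
  ... | yes _ = false
  ... | no _  = isYes (x <? a + (m ∸ b))

  data BlockView (a b x : ℕ) : ℕ → Bool → Set where
    left   : ∀ {v} → x < a → x + v ≡ b → BlockView a b x v false
    middle : ∀ {v} → a ≤ x → x < a + (m ∸ b) → x + v ≡ m + a → BlockView a b x v true
    right  : ∀ {v} → a + (m ∸ b) ≤ x → x + v ≡ m → BlockView a b x v false

  module _ {a b : ℕ} (1≤a : 1 ≤ a) (a≤1+b : a ≤ suc b) (b≤p : b ≤ p) where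

    private
      d : ℕ
      d = m ∸ b

      d+b≡m : d + b ≡ m
      d+b≡m = m∸n+n≡m (m≤n⇒m≤1+n b≤p)

    blockView : ∀ {x} → x ≤ m → BlockView a b x (blockSwap a b x) (inMiddleBlock a b x)
    blockView {x} x≤m with x <? a
    ... | yes x<a = left x<a (m+[n∸m]≡n (s≤s⁻¹ (≤-trans x<a a≤1+b)))
    ... | no x≮a with x <? a + d
    ...   | yes x<a+d = middle (≮⇒≥ x≮a) x<a+d (m+[n∸m]≡n x≤m+a)
      where
      x≤m+a : x ≤ m + a
      x≤m+a = ≤-trans (<⇒≤ x<a+d) (subst (a + d ≤_) (+-comm a m) (+-monoʳ-≤ a (m∸n≤m m b)))
    ...   | no x≮a+d = right (≮⇒≥ x≮a+d) (m+[n∸m]≡n x≤m)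

    right-value : ∀ {x v} → a + d ≤ x → x + v ≡ m → v + a ≤ b
    right-value {x} {v} a+d≤x x+v≡m = +-cancelʳ-≤ d (v + a) b (begin
      v + a + d    ≡⟨ +-assoc v a d ⟩
      v + (a + d)  ≤⟨ +-monoʳ-≤ v a+d≤x ⟩
      v + x        ≡⟨ +-comm v x ⟩
      x + v        ≡⟨ x+v≡m ⟩
      m            ≡⟨ d+b≡m ⟨
      d + b        ≡⟨ +-comm d b ⟩
      b + d        ∎)
      where open ≤-Reasoning

    middle-value : ∀ {x v} → x < a + d → x + v ≡ m + a → b < v
    middle-value {x} {v} x<a+d x+v≡m+a = +-cancelˡ-< x b v (begin-strict
      x + b        <⟨ +-monoˡ-< b x<a+d ⟩
      a + d + b    ≡⟨ +-assoc a d b ⟩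
      a + (d + b)  ≡⟨ cong (a +_) d+b≡m ⟩
      a + m        ≡⟨ +-comm a m ⟩
      m + a        ≡⟨ x+v≡m+a ⟨
      x + v        ∎)
      where open ≤-Reasoning

    outer-≤ : ∀ {x v} → BlockView a b x v false → v ≤ b
    outer-≤ {x} {v} (left _ x+v≡b)      = ≤-trans (m≤n+m v x) (≤-reflexive x+v≡b)
    outer-≤ {x} {v} (right a+d≤x x+v≡m) = ≤-trans (m≤m+n v a) (right-value a+d≤x x+v≡m)

    middle-> : ∀ {x v} → BlockView a b x v true → b < v
    middle-> (middle _ x<a+d x+v≡m+a) = middle-value x<a+d x+v≡m+a

    bounded-view : ∀ {x v r} → BlockView a b x v r → v ≤ m
    bounded-view {r = false} view = ≤-trans (outer-≤ view) (m≤n⇒m≤1+n b≤p)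
    bounded-view {x} {v} (middle a≤x _ x+v≡m+a) =
      +-cancelˡ-≤ a v m (≤-trans (+-monoˡ-≤ v a≤x) (≤-reflexive (trans x+v≡m+a (+-comm m a))))

    decreasing-views : ∀ {x y vx vy rx ry} → x < y →
      BlockView a b x vx rx → BlockView a b y vy ry → rx ≡ ry → vy < vx
    decreasing-views x<y (left _ sx)     (left _ sy)     _ = constant-sum⇒decreasing sx sy x<y
    decreasing-views x<y (middle _ _ sx) (middle _ _ sy) _ = constant-sum⇒decreasing sx sy x<y
    decreasing-views x<y (right _ sx)    (right _ sy)    _ = constant-sum⇒decreasing sx sy x<y
    decreasing-views {x} {vx = vx} {vy} x<y (left x<a x+vx≡b) (right a+d≤y y+vy≡m) _ =
      +-cancelʳ-< a vy vx (begin-strict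
        vy + a  ≤⟨ right-value a+d≤y y+vy≡m ⟩
        b       ≡⟨ x+vx≡b ⟨
        x + vx  <⟨ +-monoˡ-< vx x<a ⟩
        a + vx  ≡⟨ +-comm a vx ⟩
        vx + a  ∎)
      where open ≤-Reasoning
    decreasing-views x<y (right a+d≤x _) (left y<a _) _ =
      ⊥-elim (<-irrefl refl (≤-<-trans (≤-trans (m≤m+n a d) a+d≤x) (<-trans x<y y<a)))
    decreasing-views _ (left _ _)     (middle _ _ _) ()
    decreasing-views _ (middle _ _ _) (left _ _)     ()
    decreasing-views _ (middle _ _ _) (right _ _)    ()
    decreasing-views _ (right _ _)    (middle _ _ _) ()

    separated-views : ∀ {x y vx vy rx ry} →
      BlockView a b x vx rx → BlockView a b y vy ry → rx ≢ ry → vx ≢ vy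
    separated-views {rx = true}  {false} view-x view-y _ vx≡vy =
      <⇒≱ (middle-> view-x) (subst (_≤ b) (sym vx≡vy) (outer-≤ view-y))
    separated-views {rx = false} {true}  view-x view-y _ vx≡vy =
      <⇒≱ (middle-> view-y) (subst (_≤ b) vx≡vy (outer-≤ view-x))
    separated-views {rx = true}  {true}  _ _ rx≢ry = ⊥-elim (rx≢ry refl)
    separated-views {rx = false} {false} _ _ rx≢ry = ⊥-elim (rx≢ry refl)

    blockSwap-runs : TwoDecreasingRuns n (blockSwap a b)
    blockSwap-runs = record
      { bounded    = λ x<n → s≤s (bounded-view (blockView (s≤s⁻¹ x<n)))
      ; run        = inMiddleBlock a b
      ; decreasing = λ x<y y<n →
          decreasing-views x<y (blockView (s≤s⁻¹ (<-trans x<y y<n))) (blockView (s≤s⁻¹ y<n))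
      ; separated  = λ x<n y<n → separated-views (blockView (s≤s⁻¹ x<n)) (blockView (s≤s⁻¹ y<n))
      }

    blockSwap-0 : blockSwap a b 0 ≡ b
    blockSwap-0 = at-0 (blockView z≤n)
      where
      at-0 : ∀ {v r} → BlockView a b 0 v r → v ≡ b
      at-0 (left _ 0+v≡b)      = 0+v≡b
      at-0 (middle a≤0 _ _)    = ⊥-elim (<⇒≱ 1≤a a≤0)
      at-0 (right a+d≤0 _)     = ⊥-elim (<⇒≱ 1≤a (≤-trans (m≤m+n a d) a+d≤0))

    blockSwap-a : blockSwap a b a ≡ m
    blockSwap-a = at-a (blockView (≤-trans a≤1+b (s≤s b≤p)))
      where
      at-a : ∀ {v r} → BlockView a b a v r → v ≡ m
      at-a (left a<a _)             = ⊥-elim (<-irrefl refl a<a)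
      at-a {v} (middle _ _ a+v≡m+a) = +-cancelˡ-≡ a v m (trans a+v≡m+a (+-comm m a))
      at-a (right a+d≤a _)          = ⊥-elim (<⇒≱ (m<n⇒0<n∸m (s≤s b≤p))
        (+-cancelˡ-≤ a d 0 (subst (a + d ≤_) (sym (+-identityʳ a)) a+d≤a)))

    blockSwap-≡m : ∀ {x} → x < n → blockSwap a b x ≡ m → x ≡ a
    blockSwap-≡m x<n hit = TwoDecreasingRuns.injective blockSwap-runs x<n (s≤s (≤-trans a≤1+b (s≤s b≤p)))
      (trans hit (sym blockSwap-a))

  module Family (s : ℕ) where

    -- Lcorner n s (suc R) is row 0 from column R on together with column m down to row R.
    R : ℕ
    R = n ∸ s

    data CrossShape (u j : ℕ) : Set where
      upper : u + j < p → CrossShape u j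
      lower : suc m ≤ u + j → CrossShape u j
      atR   : u + j ≡ m → u ≡ R → CrossShape u j

    data BlockShape (u j : ℕ) : Set where
      diagonalEnd : u + j ≡ p → u ≡ 0 ⊎ u ≡ R → BlockShape u j
      diagonalMid : u + j ≡ p → u ≢ 0 → u ≢ R → BlockShape u j
      beforeR     : u + j ≡ m → u < R → BlockShape u j
      afterR      : u + j ≡ m → R < u → BlockShape u j

    data Shape (u j : ℕ) : Set where
      cross  : CrossShape u j → Shape u j
      blocks : BlockShape u j → Shape u j

    shape : ∀ u j → Shape u j
    shape u j with <-cmp (u + j) p
    ... | tri< u+j<p _ _ = cross (upper u+j<p)
    ... | tri≈ _ u+j≡p _ with u ≟ 0 | u ≟ R
    ...   | yes u≡0 | _       = blocks (diagonalEnd u+j≡p (inj₁ u≡0))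
    ...   | no _    | yes u≡R = blocks (diagonalEnd u+j≡p (inj₂ u≡R))
    ...   | no u≢0  | no u≢R  = blocks (diagonalMid u+j≡p u≢0 u≢R)
    shape u j | tri> _ _ p<u+j with m≤n⇒m<n∨m≡n p<u+j
    ... | inj₁ m<u+j = cross (lower m<u+j)
    ... | inj₂ m≡u+j with <-cmp u R
    ...   | tri< u<R _ _ = blocks (beforeR (sym m≡u+j) u<R)
    ...   | tri≈ _ u≡R _ = cross (atR (sym m≡u+j) u≡R)
    ...   | tri> _ _ R<u = blocks (afterR (sym m≡u+j) R<u)

    column : ∀ {u j} → CrossShape u j → ℕ
    column {j = j} (upper _) = j
    column {j = j} (lower _) = j
    column {j = j} (atR _ _) = pred j

    start : ∀ {u j} → BlockShape u j → ℕ
    start {u} (diagonalEnd _ _)   = suc u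
    start {u} (diagonalMid _ _ _) = suc u
    start (beforeR _ _)           = 1
    start (afterR _ _)            = suc R

    member : ∀ {u j} → Shape u j → ℕ → ℕ
    member {u} (cross c)  = insertReverse (suc u) (column c)
    member {u} (blocks b) = blockSwap (start b) u

    pivotRow pivotColumn : ∀ {u j} → Shape u j → ℕ
    pivotRow {u} (cross c)                    = suc u
    pivotRow {u} (blocks (diagonalMid _ _ _)) = suc u
    pivotRow (blocks _)                       = 0
    pivotColumn (cross c)                       = column c
    pivotColumn (blocks (diagonalMid _ _ _))    = m
    pivotColumn {u} (blocks _)                  = u

    blockRank : ∀ {u j} → BlockShape u j → ℕ
    blockRank (diagonalEnd _ _)   = 0
    blockRank (diagonalMid _ _ _) = 0
    blockRank (beforeR _ _)       = 1
    blockRank (afterR _ _)        = 1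

    crossRank : ∀ {u j} → CrossShape u j → ℕ
    crossRank (lower _) = 0
    crossRank (upper _) = 1
    crossRank (atR _ _) = 2

    -- A lower cross may contain the pivot of an upper one, and any cross that of the atR one.
    rank : ∀ {u j} → Shape u j → ℕ
    rank (blocks b) = blockRank b
    rank (cross c)  = 2 + crossRank c

    blockRank≤1 : ∀ {u j} (b : BlockShape u j) → blockRank b ≤ 1
    blockRank≤1 (diagonalEnd _ _)   = z≤n
    blockRank≤1 (diagonalMid _ _ _) = z≤n
    blockRank≤1 (beforeR _ _)       = ≤-refl
    blockRank≤1 (afterR _ _)        = ≤-refl

    InL : ℕ → ℕ → Set
    InL x y = (x ≡ 0 × R ≤ y) ⊎ (suc y ≡ n × x < suc R)

    insertReverse-hits : ∀ {i j} → 1 ≤ i → i ≤ m → j ≤ p → HitsExactlyOnceℕ n InL (insertReverse i j)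
    insertReverse-hits {i} {j} 1≤i i≤m j≤p =
      0 , z<s , inj₂ (cong suc (insertReverse-0 1≤i j≤p) , z<s) , unique
      where
      unique : ∀ x → x < n → InL x (insertReverse i j x) → x ≡ 0
      unique x _   (inj₁ (x≡0 , _))  = x≡0
      unique x x<n (inj₂ (hit-m , _)) = insertReverse-≡m 1≤i i≤m j≤p x<n (suc-injective hit-m)

    blockSwap-hits : ∀ {a b} → 1 ≤ a → a ≤ suc b → b ≤ p → (R ≤ b × R < a) ⊎ (b < R × a ≤ R) →
      HitsExactlyOnceℕ n InL (blockSwap a b)
    blockSwap-hits {a} {b} 1≤a a≤1+b b≤p (inj₁ (R≤b , R<a)) =
      0 , z<s , inj₁ (refl , subst (R ≤_) (sym (blockSwap-0 1≤a a≤1+b b≤p)) R≤b) , unique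
      where
      unique : ∀ x → x < n → InL x (blockSwap a b x) → x ≡ 0
      unique x _   (inj₁ (x≡0 , _))      = x≡0
      unique x x<n (inj₂ (hit-m , x≤R)) = ⊥-elim (<⇒≱ R<a
        (subst (_≤ R) (blockSwap-≡m 1≤a a≤1+b b≤p x<n (suc-injective hit-m)) (s≤s⁻¹ x≤R)))
    blockSwap-hits {a} {b} 1≤a a≤1+b b≤p (inj₂ (b<R , a≤R)) =
      a , s≤s (≤-trans a≤1+b (s≤s b≤p)) ,
      inj₂ (cong suc (blockSwap-a 1≤a a≤1+b b≤p) , s≤s a≤R) , unique
      where
      unique : ∀ x → x < n → InL x (blockSwap a b x) → x ≡ a
      unique x _   (inj₁ (refl , R≤f0)) =
        ⊥-elim (<⇒≱ b<R (subst (R ≤_) (blockSwap-0 1≤a a≤1+b b≤p) R≤f0))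
      unique x x<n (inj₂ (hit-m , _))   = blockSwap-≡m 1≤a a≤1+b b≤p x<n (suc-injective hit-m)

    module _ {u j : ℕ} (u≤p : u ≤ p) (j≤p : j ≤ p) where

      column-≤ : (c : CrossShape u j) → column c ≤ p
      column-≤ (upper _) = j≤p
      column-≤ (lower _) = j≤p
      column-≤ (atR _ _) = ≤-trans pred[n]≤n j≤p

      1≤start : (b : BlockShape u j) → 1 ≤ start b
      1≤start (diagonalEnd _ _)   = s≤s z≤n
      1≤start (diagonalMid _ _ _) = s≤s z≤n
      1≤start (beforeR _ _)       = s≤s z≤n
      1≤start (afterR _ _)        = s≤s z≤n

      start-≤ : (b : BlockShape u j) → start b ≤ suc u
      start-≤ (diagonalEnd _ _)   = ≤-refl
      start-≤ (diagonalMid _ _ _) = ≤-refl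
      start-≤ (beforeR _ _)       = s≤s z≤n
      start-≤ (afterR _ R<u)      = s≤s (<⇒≤ R<u)

      member-runs : (v : Shape u j) → TwoDecreasingRuns n (member v)
      member-runs (cross c)  = insertReverse-runs (s≤s u≤p) (m≤n⇒m≤1+n (column-≤ c))
      member-runs (blocks b) = blockSwap-runs (1≤start b) (start-≤ b) u≤p

      member-pivot : (v : Shape u j) → member v (pivotRow v) ≡ pivotColumn v
      member-pivot (cross c)                      = insertReverse-≡ (suc u) (column c)
      member-pivot (blocks b@(diagonalMid _ _ _)) = blockSwap-a (1≤start b) (start-≤ b) u≤p
      member-pivot (blocks b@(diagonalEnd _ _))   = blockSwap-0 (1≤start b) (start-≤ b) u≤p
      member-pivot (blocks b@(beforeR _ _))       = blockSwap-0 (1≤start b) (start-≤ b) u≤p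
      member-pivot (blocks b@(afterR _ _))        = blockSwap-0 (1≤start b) (start-≤ b) u≤p

      pivot-< : (v : Shape u j) → pivotRow v < n × pivotColumn v < n
      pivot-< (cross c)                    = s≤s (s≤s u≤p) , s≤s (m≤n⇒m≤1+n (column-≤ c))
      pivot-< (blocks (diagonalMid _ _ _)) = s≤s (s≤s u≤p) , ≤-refl
      pivot-< (blocks (diagonalEnd _ _))   = s≤s z≤n , s≤s (m≤n⇒m≤1+n u≤p)
      pivot-< (blocks (beforeR _ _))       = s≤s z≤n , s≤s (m≤n⇒m≤1+n u≤p)
      pivot-< (blocks (afterR _ _))        = s≤s z≤n , s≤s (m≤n⇒m≤1+n u≤p)

      cross-0 : (c : CrossShape u j) → member (cross c) 0 ≡ m
      cross-0 c = insertReverse-0 {suc u} z<s (column-≤ c)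

      cross-m : (c : CrossShape u j) → ∀ {x} → x < n → member (cross c) x ≡ m → x ≡ 0
      cross-m c = insertReverse-≡m z<s (s≤s u≤p) (column-≤ c)

      blocks-0 : (b : BlockShape u j) → member (blocks b) 0 ≡ u
      blocks-0 b = blockSwap-0 (1≤start b) (start-≤ b) u≤p

      blocks-m : (b : BlockShape u j) → ∀ {x} → x < n → member (blocks b) x ≡ m → x ≡ start b
      blocks-m b = blockSwap-≡m (1≤start b) (start-≤ b) u≤p

      member-hits : (v : Shape u j) → HitsExactlyOnceℕ n InL (member v)
      member-hits (cross c)  = insertReverse-hits z<s (s≤s u≤p) (column-≤ c)
      member-hits (blocks b) = blockSwap-hits (1≤start b) (start-≤ b) u≤p (corner-side b)
        where
        diagonal-side : (R ≤ u × R < suc u) ⊎ (u < R × suc u ≤ R)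
        diagonal-side with R ≤? u
        ... | yes R≤u = inj₁ (R≤u , s≤s R≤u)
        ... | no R≰u  = inj₂ (≰⇒> R≰u , ≰⇒> R≰u)

        corner-side : (b : BlockShape u j) → (R ≤ u × R < start b) ⊎ (u < R × start b ≤ R)
        corner-side (diagonalEnd _ _)   = diagonal-side
        corner-side (diagonalMid _ _ _) = diagonal-side
        corner-side (beforeR _ u<R)     = inj₂ (u<R , ≤-trans (s≤s z≤n) u<R)
        corner-side (afterR _ R<u)      = inj₁ (<⇒≤ R<u , ≤-refl)

    atR-column : ∀ {u j} → u ≤ p → u + j ≡ m → u + pred j ≡ p
    atR-column {u} {zero}  u≤p u+0≡m   =
      ⊥-elim (1+n≰n (subst (_≤ p) (trans (sym (+-identityʳ u)) u+0≡m) u≤p))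
    atR-column {u} {suc j} _   u+1+j≡m = suc-injective (trans (sym (+-suc u j)) u+1+j≡m)

    column-cases : ∀ {u j} → u ≤ p → (c : CrossShape u j) → column c ≡ j ⊎ u + column c ≡ p
    column-cases _   (upper _)        = inj₁ refl
    column-cases _   (lower _)        = inj₁ refl
    column-cases u≤p (atR u+j≡m _)    = inj₂ (atR-column u≤p u+j≡m)

    hub-off-end : ∀ {u j} → j ≤ p → u + j ≡ m → u ≢ R → u ≡ 0 ⊎ u ≡ R → ⊥
    hub-off-end j≤p j≡m _   (inj₁ refl) = 1+n≰n (subst (_≤ p) j≡m j≤p)
    hub-off-end _   _   u≢R (inj₂ u≡R)  = u≢R u≡R

    module Triangular {u j u′ j′ : ℕ} (u≤p : u ≤ p) (u′≤p : u′ ≤ p) (j′≤p : j′ ≤ p) where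

      cross-cross : (c : CrossShape u j) (c′ : CrossShape u′ j′) → member (cross c′) (suc u) ≡ column c →
        (u′ ≡ u × j′ ≡ j) ⊎ rank (cross c′) < rank (cross c)
      cross-cross (atR u+j≡m u≡R) (atR u′+j′≡m u′≡R) _ =
        inj₁ (same-antidiagonal (trans u′≡R (sym u≡R)) u′+j′≡m u+j≡m)
      cross-cross (atR _ _) (upper _) _ = inj₂ ≤-refl
      cross-cross (atR _ _) (lower _) _ = inj₂ (s<s (s<s z<s))
      cross-cross (upper _) (lower _) _ = inj₂ ≤-refl
      cross-cross (upper u+j<p) (upper u′+j′<p) hit with insertReverse-hit (s≤s u≤p) (s≤s u′≤p) hit
      ... | inj₁ (1+u≡1+u′ , j≡j′) = inj₁ (sym (suc-injective 1+u≡1+u′) , sym j≡j′)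
      ... | inj₂ (_ , lower-band)  = ⊥-elim (<⇒≱ u+j<p (s≤s⁻¹ (lower-band (s≤s (<⇒≤ u′+j′<p)))))
      cross-cross (upper u+j<p) (atR u′+j′≡m _) hit with insertReverse-hit (s≤s u≤p) (s≤s u′≤p) hit
      ... | inj₁ (1+u≡1+u′ , j≡ĵ′) = ⊥-elim (<⇒≢ u+j<p
        (trans (cong₂ _+_ (suc-injective 1+u≡1+u′) j≡ĵ′) (atR-column u′≤p u′+j′≡m)))
      ... | inj₂ (_ , lower-band)  = ⊥-elim (<⇒≱ u+j<p
        (s≤s⁻¹ (lower-band (≤-reflexive (cong suc (atR-column u′≤p u′+j′≡m))))))
      cross-cross (lower m<u+j) c′ hit with insertReverse-hit (s≤s u≤p) (s≤s u′≤p) hit | column-cases u′≤p c′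
      ... | inj₂ (upper-band , _)  | _            = ⊥-elim (<⇒≱ m<u+j (s≤s⁻¹ upper-band))
      ... | inj₁ (1+u≡1+u′ , j≡ĵ′) | inj₁ ĵ′≡j′   =
        inj₁ (sym (suc-injective 1+u≡1+u′) , sym (trans j≡ĵ′ ĵ′≡j′))
      ... | inj₁ (1+u≡1+u′ , j≡ĵ′) | inj₂ u′+ĵ′≡p = ⊥-elim (<⇒≢ (≤-trans (n≤1+n m) m<u+j)
        (sym (trans (cong₂ _+_ (suc-injective 1+u≡1+u′) j≡ĵ′) u′+ĵ′≡p)))

      cross-misses-row : (c′ : CrossShape u′ j′) → member (cross c′) 0 ≢ u
      cross-misses-row c′ hit = 1+n≰n (subst (_≤ p) (trans (sym hit) (cross-0 u′≤p j′≤p c′)) u≤p)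

      blocks-row : (b′ : BlockShape u′ j′) → member (blocks b′) 0 ≡ u → u′ ≡ u
      blocks-row b′ hit = trans (sym (blocks-0 u′≤p j′≤p b′)) hit

      end-row : u + j ≡ p → u ≡ 0 ⊎ u ≡ R → (b′ : BlockShape u′ j′) → u′ ≡ u → u′ ≡ u × j′ ≡ j
      end-row u+j≡p _ (diagonalEnd u′+j′≡p _)   u′≡u = same-antidiagonal u′≡u u′+j′≡p u+j≡p
      end-row u+j≡p _ (diagonalMid u′+j′≡p _ _) u′≡u = same-antidiagonal u′≡u u′+j′≡p u+j≡p
      end-row _ end (beforeR u′+j′≡m u′<R) refl =
        ⊥-elim (hub-off-end j′≤p u′+j′≡m (<⇒≢ u′<R) end)
      end-row _ end (afterR u′+j′≡m R<u′)  refl =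
        ⊥-elim (hub-off-end j′≤p u′+j′≡m (≢-sym (<⇒≢ R<u′)) end)

      hub-row : u + j ≡ m → (b′ : BlockShape u′ j′) → u′ ≡ u → (u′ ≡ u × j′ ≡ j) ⊎ blockRank b′ < 1
      hub-row _     (diagonalEnd _ _)   _    = inj₂ ≤-refl
      hub-row _     (diagonalMid _ _ _) _    = inj₂ ≤-refl
      hub-row u+j≡m (beforeR u′+j′≡m _) u′≡u = inj₁ (same-antidiagonal u′≡u u′+j′≡m u+j≡m)
      hub-row u+j≡m (afterR u′+j′≡m _)  u′≡u = inj₁ (same-antidiagonal u′≡u u′+j′≡m u+j≡m)

      mid-column : u + j ≡ p → u ≢ 0 → u ≢ R → (b′ : BlockShape u′ j′) → suc u ≡ start b′ →
        u′ ≡ u × j′ ≡ j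
      mid-column u+j≡p _ _ (diagonalEnd u′+j′≡p _) 1+u≡1+u′ =
        same-antidiagonal (sym (suc-injective 1+u≡1+u′)) u′+j′≡p u+j≡p
      mid-column u+j≡p _ _ (diagonalMid u′+j′≡p _ _) 1+u≡1+u′ =
        same-antidiagonal (sym (suc-injective 1+u≡1+u′)) u′+j′≡p u+j≡p
      mid-column _ u≢0 _ (beforeR _ _) 1+u≡1   = ⊥-elim (u≢0 (suc-injective 1+u≡1))
      mid-column _ _ u≢R (afterR _ _) 1+u≡1+R = ⊥-elim (u≢R (suc-injective 1+u≡1+R))

      triangular : (v : Shape u j) (v′ : Shape u′ j′) → member v′ (pivotRow v) ≡ pivotColumn v →
        (u′ ≡ u × j′ ≡ j) ⊎ rank v′ < rank v
      triangular (cross c) (cross c′) hit = cross-cross c c′ hit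
      triangular (cross c) (blocks b′) _  = inj₂ (≤-trans (s≤s (blockRank≤1 b′)) (m≤m+n 2 (crossRank c)))
      triangular (blocks (diagonalMid _ _ _)) (cross c′) hit =
        ⊥-elim (1+n≢0 (cross-m u′≤p j′≤p c′ (s≤s (s≤s u≤p)) hit))
      triangular (blocks (diagonalEnd _ _)) (cross c′) hit = ⊥-elim (cross-misses-row c′ hit)
      triangular (blocks (beforeR _ _))     (cross c′) hit = ⊥-elim (cross-misses-row c′ hit)
      triangular (blocks (afterR _ _))      (cross c′) hit = ⊥-elim (cross-misses-row c′ hit)
      triangular (blocks (diagonalMid u+j≡p u≢0 u≢R)) (blocks b′) hit =
        inj₁ (mid-column u+j≡p u≢0 u≢R b′ (blocks-m u′≤p j′≤p b′ (s≤s (s≤s u≤p)) hit))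
      triangular (blocks (diagonalEnd u+j≡p end)) (blocks b′) hit =
        inj₁ (end-row u+j≡p end b′ (blocks-row b′ hit))
      triangular (blocks (beforeR u+j≡m _))       (blocks b′) hit = hub-row u+j≡m b′ (blocks-row b′ hit)
      triangular (blocks (afterR u+j≡m _))        (blocks b′) hit = hub-row u+j≡m b′ (blocks-row b′ hit)

    index₁ index₂ : Fin (m * m) → ℕ
    index₁ k = toℕ (proj₁ (F.remQuot {m} m k))
    index₂ k = toℕ (proj₂ (F.remQuot {m} m k))

    index₁≤p : ∀ k → index₁ k ≤ p
    index₁≤p k = s≤s⁻¹ (F.toℕ<n (proj₁ (F.remQuot {m} m k)))

    index₂≤p : ∀ k → index₂ k ≤ p
    index₂≤p k = s≤s⁻¹ (F.toℕ<n (proj₂ (F.remQuot {m} m k)))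

    index-injective : ∀ {k k′} → index₁ k′ ≡ index₁ k × index₂ k′ ≡ index₂ k → k′ ≡ k
    index-injective {k} {k′} (≡₁ , ≡₂) = begin
      k′                                      ≡⟨ F.combine-remQuot {m} m k′ ⟨
      uncurry F.combine (F.remQuot {m} m k′)  ≡⟨ cong₂ F.combine (F.toℕ-injective ≡₁)
                                                                  (F.toℕ-injective ≡₂) ⟩
      uncurry F.combine (F.remQuot {m} m k)   ≡⟨ F.combine-remQuot {m} m k ⟩
      k                                       ∎
      where open ≡-Reasoning

    shapeAt : ∀ k → Shape (index₁ k) (index₂ k)
    shapeAt k = shape (index₁ k) (index₂ k)

    runsAt : ∀ k → TwoDecreasingRuns n (member (shapeAt k))
    runsAt k = member-runs (index₁≤p k) (index₂≤p k) (shapeAt k)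

    memberAt : Fin (m * m) → Permutation′ n
    memberAt k = TwoDecreasingRuns.toPermutation (runsAt k)

    pivotRowAt pivotColumnAt : Fin (m * m) → Fin n
    pivotRowAt    k = fromℕ< (proj₁ (pivot-< (index₁≤p k) (index₂≤p k) (shapeAt k)))
    pivotColumnAt k = fromℕ< (proj₂ (pivot-< (index₁≤p k) (index₂≤p k) (shapeAt k)))

    toℕ-memberAt-pivotRowAt : ∀ k k′ →
      toℕ (memberAt k′ ⟨$⟩ʳ pivotRowAt k) ≡ member (shapeAt k′) (pivotRow (shapeAt k))
    toℕ-memberAt-pivotRowAt k k′ =
      trans (TwoDecreasingRuns.toℕ-toPermutation (runsAt k′) (pivotRowAt k))
        (cong (member (shapeAt k′)) (F.toℕ-fromℕ< _))

    memberAt-pivot : ∀ k → memberAt k ⟨$⟩ʳ pivotRowAt k ≡ pivotColumnAt k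
    memberAt-pivot k = F.toℕ-injective (trans (toℕ-memberAt-pivotRowAt k k)
      (trans (member-pivot (index₁≤p k) (index₂≤p k) (shapeAt k)) (sym (F.toℕ-fromℕ< _))))

    memberAt-triangular : ∀ k k′ → memberAt k′ ⟨$⟩ʳ pivotRowAt k ≡ pivotColumnAt k →
      k′ ≡ k ⊎ rank (shapeAt k′) < rank (shapeAt k)
    memberAt-triangular k k′ hit = map₁ index-injective
      (Triangular.triangular (index₁≤p k) (index₁≤p k′) (index₂≤p k′) (shapeAt k) (shapeAt k′)
        (trans (sym (toℕ-memberAt-pivotRowAt k k′)) (trans (cong toℕ hit) (F.toℕ-fromℕ< _))))

    family : SingleHitFamily (m * m) (Lcorner n s (suc R))
    family = memberAt ,
      linearlyIndependent-triangular memberAt pivotRowAt pivotColumnAt (rank ∘ shapeAt)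
        memberAt-pivot memberAt-triangular ,
      λ k → TwoDecreasingRuns.toPermutation-avoids123 (runsAt k) ,
            toPermutation-hitsExactlyOnce (runsAt k) {InL}
              (member-hits (index₁≤p k) (index₂≤p k) (shapeAt k))

Lcorner-family : ∀ p s R → R + s ≡ suc (suc p) →
  SingleHitFamily (suc p * suc p) (Lcorner (suc (suc p)) s (suc R))
Lcorner-family p s R R+s≡n =
  subst (λ R → SingleHitFamily (suc p * suc p) (Lcorner (suc (suc p)) s (suc R)))
    (trans (cong (_∸ s) (sym R+s≡n)) (m+n∸n≡m R s)) (Construction.Family.family p s)

corollary4p8 : (n : ℕ) → 1 ≤ n → (Q : PosSet n) → IsLShaped Q → IsMinimumBlocker Q →
    Σ (Fin ((n ∸ 1) * (n ∸ 1)) → Permutation′ n) λ P →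
      LinearlyIndependent P × (∀ k → Avoids123 (P k) × HitsExactlyOnce Q (P k))
corollary4p8 (suc zero) _ _ _ _ = (λ ()) , (λ _ _ ()) , (λ ())
corollary4p8 (suc (suc p)) _ Q (s , suc R , _ , _ , 1+R+s≡1+n , inj₁ Q≈Lcorner) _ =
  singleHitFamily-sameSet Q≈Lcorner (Lcorner-family p s R (suc-injective 1+R+s≡1+n))
corollary4p8 (suc (suc p)) _ Q (s , suc R , _ , _ , 1+R+s≡1+n , inj₂ Q≈Lrotated) _ =
  singleHitFamily-sameSet Q≈Lrotated
    (singleHitFamily-sameSet (Lrotated≈rotateSet-Lcorner (suc (suc p)) s (suc R))
      (singleHitFamily-rotate {Q = Lcorner (suc (suc p)) s (suc R)}
        (Lcorner-family p s R (suc-injective 1+R+s≡1+n))))
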